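{- Let $S$ be a c-trioid and $d(S)=\{x\in S\mid d(x)=x\}$ where $d(x)=(x\cdot 1_\pi)\|1_\sigma$. Then $0,1_\sigma\in d(S)$, $d(S)$ is closed under $+$, $\cdot$ and $\|$, $x\cdot y=x\|y$ for all $x,y\in d(S)$, and $(d(S),+,\cdot)$ is a bounded distributive lattice (with join $+$ and meet $\cdot$, with respect to the order $\le$ of $S$) with least element $0$ and greatest element $1_\sigma$.
   Context: A proto-dioid is $(S,+,\cdot,0,1_\sigma)$ where $(S,+,0)$ is a (join) semilattice with least element $0$ (order $x\le y\iff x+y=y$), $1_\sigma\cdot x=x=x\cdot 1_\sigma$, and $x\cdot y+x\cdot z\le x\cdot(y+z)$, $(x+y)\cdot z=x\cdot z+y\cdot z$, $0\cdot x=0$. A commutative dioid $(S,+,\|,0,1_\pi)$: $(S,+,0)$ as before, $\|$ associative and commutative with unit $1_\pi$, distributing over $+$, with $0\|x=0$. A proto-trioid is $(S,+,\cdot,\|,0,1_\sigma,1_\pi)$ such that $(S,+,\cdot,0,1_\sigma)$ is a proto-dioid and $(S,+,\|,0,1_\pi)$ a commutative dioid. A c-trioid is a proto-trioid satisfying for all $x,y$: (c1) $(x\cdot 1_\pi)\|x=x$; (c2) $((x\cdot 1_\pi)\|1_\sigma)\cdot y=(x\cdot 1_\pi)\|y$; (c3) $(x\|y)\cdot 1_\pi=(x\cdot 1_\pi)\|(y\cdot 1_\pi)$; (c4) $(x\cdot y)\cdot 1_\pi=x\cdot(y\cdot 1_\pi)$; (c5) $1_\sigma\|1_\sigma=1_\sigma$;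 (c6) $x\cdot 1_\pi\le 1_\pi$. -}

module Defs where

open import Level using (Level; suc; _⊔_)
open import Data.Product using (Σ; _,_; proj₁; _×_)
open import Relation.Binary.PropositionalEquality using (_≡_)

-- A c-trioid, exactly as in the paper (no associativity of · is assumed:
-- a proto-dioid only requires 1σ to be a two-sided unit of ·).
record CTrioid (c : Level) : Set (suc c) where
  infixl 6 _+_
  infixl 7 _·_
  infixl 7 _∥_
  infix 4 _≤_
  field
    Carrier : Set c
    _+_ _·_ _∥_ : Carrier → Carrier → Carrier
    𝟘 1σ 1π : Carrier

  _≤_ : Carrier → Carrier → Set c
  x ≤ y = x + y ≡ y

  field
    +-assoc     : ∀ x y z → (x + y) + z ≡ x + (y + z)
    +-comm      : ∀ x y → x + y ≡ y + x
    +-idem      : ∀ x → x + x ≡ x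
    +-identityˡ : ∀ x → 𝟘 + x ≡ x
    ·-identityˡ : ∀ x → 1σ · x ≡ x
    ·-identityʳ : ∀ x → x · 1σ ≡ x
    ·-subdistribˡ : ∀ x y z → x · y + x · z ≤ x · (y + z)
    ·-distribʳ  : ∀ x y z → (x + y) · z ≡ x · z + y · z
    ·-zeroˡ     : ∀ x → 𝟘 · x ≡ 𝟘
    ∥-assoc     : ∀ x y z → (x ∥ y) ∥ z ≡ x ∥ (y ∥ z)
    ∥-comm      : ∀ x y → x ∥ y ≡ y ∥ x
    ∥-identityˡ : ∀ x → 1π ∥ x ≡ x
    ∥-distribˡ  : ∀ x y z → x ∥ (y + z) ≡ x ∥ y + x ∥ z
    ∥-zeroˡ     : ∀ x → 𝟘 ∥ x ≡ 𝟘
    c1 : ∀ x → (x · 1π) ∥ x ≡ x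
    c2 : ∀ x y → ((x · 1π) ∥ 1σ) · y ≡ (x · 1π) ∥ y
    c3 : ∀ x y → (x ∥ y) · 1π ≡ (x · 1π) ∥ (y · 1π)
    c4 : ∀ x y → (x · y) · 1π ≡ x · (y · 1π)
    c5 : 1σ ∥ 1σ ≡ 1σ
    c6 : ∀ x → x · 1π ≤ 1π

  d : Carrier → Carrier
  d x = (x · 1π) ∥ 1σ

  InD : Carrier → Set c
  InD x = d x ≡ x

  DS : Set c
  DS = Σ Carrier InD

  _≈D_ : DS → DS → Set c
  a ≈D b = proj₁ a ≡ proj₁ b

  _≤D_ : DS → DS → Set c
  a ≤D b = proj₁ a ≤ proj₁ b

  restrict : (op : Carrier → Carrier → Carrier) →
             (∀ x y → InD x → InD y → InD (op x y)) → DS → DS → DS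
  restrict op cl (x , px) (y , py) = op x y , cl x y px py

  ClosedUnder : (Carrier → Carrier → Carrier) → Set c
  ClosedUnder op = ∀ x y → InD x → InD y → InD (op x y)

module Submission where

open import Defs
open import Level using (Level)
open import Data.Product using (Σ; _×_; _,_; proj₁)
open import Relation.Binary.PropositionalEquality using (_≡_)
open import Relation.Binary.Definitions using (Minimum; Maximum)
open import Relation.Binary.Lattice.Structures using (IsDistributiveLattice)

open import Algebra.Bundles using (CommutativeSemigroup)
import Algebra.Properties.CommutativeSemigroup as CommutativeSemigroupProperties
open import Relation.Binary.PropositionalEquality
  using (refl; sym; trans; cong; cong₂; subst; subst₂; isEquivalence; module ≡-Reasoning)
open import Relation.Binary.PropositionalEquality.Algebra using (isMagma)
open import Relation.Binary.Structures using (IsPartialOrder)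
open import Relation.Binary.Lattice.Definitions using (Supremum; Infimum)
import Relation.Binary.Construct.On as On

-- d is a +- and ∥-homomorphism fixing 0 and 1σ, so d(S) is closed under +, ∥ and
-- contains 0, 1σ. On d(S), (c2) and (c5) make · coincide with ∥, and (c1) makes
-- ∥ idempotent; together with (c6), which puts d(S) below 1σ, this makes ∥ the meet
-- of d(S), and ∥ distributes over +.

module _ {c : Level} (S : CTrioid c) where
  open CTrioid S
  open ≡-Reasoning

  ≤-trans : ∀ {x y z} → x ≤ y → y ≤ z → x ≤ z
  ≤-trans {x} {y} {z} x≤y y≤z = begin
    x + z        ≡⟨ cong (x +_) y≤z ⟨
    x + (y + z)  ≡⟨ +-assoc x y z ⟨
    (x + y) + z  ≡⟨ cong (_+ z) x≤y ⟩
    y + z        ≡⟨ y≤z ⟩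
    z            ∎

  ≤-isPartialOrder : IsPartialOrder _≡_ _≤_
  ≤-isPartialOrder = record
    { isPreorder = record
      { isEquivalence = isEquivalence
      ; reflexive     = λ { {x} refl → +-idem x }
      ; trans         = ≤-trans
      }
    ; antisym = λ {x} {y} x≤y y≤x → trans (sym y≤x) (trans (+-comm y x) x≤y)
    }

  +-supremum : Supremum _≤_ _+_
  +-supremum x y = x≤x+y , y≤x+y , +-lub
    where
    x≤x+y : x ≤ x + y
    x≤x+y = trans (sym (+-assoc x x y)) (cong (_+ y) (+-idem x))

    y≤x+y : y ≤ x + y
    y≤x+y = begin
      y + (x + y)  ≡⟨ cong (y +_) (+-comm x y) ⟩
      y + (y + x)  ≡⟨ +-assoc y y x ⟨
      (y + y) + x  ≡⟨ cong (_+ x) (+-idem y) ⟩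
      y + x        ≡⟨ +-comm y x ⟩
      x + y        ∎

    +-lub : ∀ z → x ≤ z → y ≤ z → x + y ≤ z
    +-lub z x≤z y≤z = trans (+-assoc x y z) (trans (cong (x +_) y≤z) x≤z)

  ∥-commutativeSemigroup : CommutativeSemigroup c c
  ∥-commutativeSemigroup = record
    { isCommutativeSemigroup = record
      { isSemigroup = record { isMagma = isMagma _∥_ ; assoc = ∥-assoc }
      ; comm        = ∥-comm
      }
    }

  open CommutativeSemigroupProperties ∥-commutativeSemigroup
    using () renaming (interchange to ∥-interchange)

  ∥-distribʳ : ∀ x y z → (y + z) ∥ x ≡ y ∥ x + z ∥ x
  ∥-distribʳ x y z = begin
    (y + z) ∥ x    ≡⟨ ∥-comm (y + z) x ⟩
    x ∥ (y + z)    ≡⟨ ∥-distribˡ x y z ⟩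
    x ∥ y + x ∥ z  ≡⟨ cong₂ _+_ (∥-comm x y) (∥-comm x z) ⟩
    y ∥ x + z ∥ x  ∎

  ∥-monoʳ-≤ : ∀ x {y z} → y ≤ z → x ∥ y ≤ x ∥ z
  ∥-monoʳ-≤ x {y} {z} y≤z = trans (sym (∥-distribˡ x y z)) (cong (x ∥_) y≤z)

  ∥-mono-≤ : ∀ {w x y z} → w ≤ x → y ≤ z → w ∥ y ≤ x ∥ z
  ∥-mono-≤ {w} {x} {y} {z} w≤x y≤z =
    ≤-trans (∥-monoʳ-≤ w y≤z) (subst₂ _≤_ (∥-comm z w) (∥-comm z x) (∥-monoʳ-≤ z w≤x))

  𝟘∈d : InD 𝟘
  𝟘∈d = trans (cong (_∥ 1σ) (·-zeroˡ 1π)) (∥-zeroˡ 1σ)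

  1σ∈d : InD 1σ
  1σ∈d = trans (cong (_∥ 1σ) (·-identityˡ 1π)) (∥-identityˡ 1σ)

  d-+ : ∀ x y → d (x + y) ≡ d x + d y
  d-+ x y = trans (cong (_∥ 1σ) (·-distribʳ x y 1π)) (∥-distribʳ 1σ (x · 1π) (y · 1π))

  d-∥ : ∀ x y → d (x ∥ y) ≡ d x ∥ d y
  d-∥ x y = begin
    ((x ∥ y) · 1π) ∥ 1σ                  ≡⟨ cong (_∥ 1σ) (c3 x y) ⟩
    ((x · 1π) ∥ (y · 1π)) ∥ 1σ           ≡⟨ cong (((x · 1π) ∥ (y · 1π)) ∥_) c5 ⟨
    ((x · 1π) ∥ (y · 1π)) ∥ (1σ ∥ 1σ)    ≡⟨ ∥-interchange (x · 1π) (y · 1π) 1σ 1σ ⟩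
    ((x · 1π) ∥ 1σ) ∥ ((y · 1π) ∥ 1σ)    ∎

  d-∥-1σ : ∀ x → d x ∥ 1σ ≡ d x
  d-∥-1σ x = trans (∥-assoc (x · 1π) 1σ 1σ) (cong ((x · 1π) ∥_) c5)

  d≤1σ : ∀ x → d x ≤ 1σ
  d≤1σ x = begin
    (x · 1π) ∥ 1σ + 1σ         ≡⟨ cong ((x · 1π) ∥ 1σ +_) (∥-identityˡ 1σ) ⟨
    (x · 1π) ∥ 1σ + 1π ∥ 1σ    ≡⟨ ∥-distribʳ 1σ (x · 1π) 1π ⟨
    ((x · 1π) + 1π) ∥ 1σ       ≡⟨ cong (_∥ 1σ) (c6 x) ⟩
    1π ∥ 1σ                    ≡⟨ ∥-identityˡ 1σ ⟩
    1σ                         ∎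

  InD⇒∥-identityʳ : ∀ {x} → InD x → x ∥ 1σ ≡ x
  InD⇒∥-identityʳ {x} x∈d = subst (λ u → u ∥ 1σ ≡ u) x∈d (d-∥-1σ x)

  InD⇒≤1σ : ∀ {x} → InD x → x ≤ 1σ
  InD⇒≤1σ {x} x∈d = subst (_≤ 1σ) x∈d (d≤1σ x)

  InD⇒·≡∥ : ∀ {x y} → InD x → y ∥ 1σ ≡ y → x · y ≡ x ∥ y
  InD⇒·≡∥ {x} {y} x∈d y∥1σ≡y = begin
    x · y                  ≡⟨ cong (_· y) x∈d ⟨
    ((x · 1π) ∥ 1σ) · y    ≡⟨ c2 x y ⟩
    (x · 1π) ∥ y           ≡⟨ cong ((x · 1π) ∥_) (trans (∥-comm 1σ y) y∥1σ≡y) ⟨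
    (x · 1π) ∥ (1σ ∥ y)    ≡⟨ ∥-assoc (x · 1π) 1σ y ⟨
    ((x · 1π) ∥ 1σ) ∥ y    ≡⟨ cong (_∥ y) x∈d ⟩
    x ∥ y                  ∎

  ·≡∥ : ∀ x y → InD x → InD y → x · y ≡ x ∥ y
  ·≡∥ x y x∈d y∈d = InD⇒·≡∥ x∈d (InD⇒∥-identityʳ y∈d)

  InD⇒∥-idem : ∀ {x} → InD x → x ∥ x ≡ x
  InD⇒∥-idem {x} x∈d = begin
    x ∥ x                ≡⟨ ·≡∥ x x x∈d x∈d ⟨
    x · x                ≡⟨ cong (_· x) x∈d ⟨
    ((x · 1π) ∥ 1σ) · x  ≡⟨ c2 x x ⟩
    (x · 1π) ∥ x         ≡⟨ c1 x ⟩
    x                    ∎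

  +-closed : ClosedUnder _+_
  +-closed x y x∈d y∈d = trans (d-+ x y) (cong₂ _+_ x∈d y∈d)

  ∥-closed : ClosedUnder _∥_
  ∥-closed x y x∈d y∈d = trans (d-∥ x y) (cong₂ _∥_ x∈d y∈d)

  ·-closed : ClosedUnder _·_
  ·-closed x y x∈d y∈d = subst InD (sym (·≡∥ x y x∈d y∈d)) (∥-closed x y x∈d y∈d)

  _∨D_ _∧D_ : DS → DS → DS
  _∨D_ = restrict _+_ +-closed
  _∧D_ = restrict _·_ ·-closed

  ∨D-supremum : Supremum _≤D_ _∨D_
  ∨D-supremum (x , _) (y , _) with +-supremum x y
  ... | x≤x+y , y≤x+y , +-lub = x≤x+y , y≤x+y , λ (z , _) → +-lub z

  ∧D-infimum : Infimum _≤D_ _∧D_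
  ∧D-infimum (x , x∈d) (y , y∈d) rewrite ·≡∥ x y x∈d y∈d =
    x∥y≤x , x∥y≤y , λ (z , z∈d) z≤x z≤y → subst (_≤ x ∥ y) (InD⇒∥-idem z∈d) (∥-mono-≤ z≤x z≤y)
    where
    x∥y≤x : x ∥ y ≤ x
    x∥y≤x = subst (x ∥ y ≤_) (InD⇒∥-identityʳ x∈d) (∥-monoʳ-≤ x (InD⇒≤1σ y∈d))

    x∥y≤y : x ∥ y ≤ y
    x∥y≤y = subst (x ∥ y ≤_) (trans (∥-comm 1σ y) (InD⇒∥-identityʳ y∈d))
                  (∥-mono-≤ (InD⇒≤1σ x∈d) (+-idem y))

  ∧D-distribˡ-∨D : ∀ x y z → (x ∧D (y ∨D z)) ≈D ((x ∧D y) ∨D (x ∧D z))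
  ∧D-distribˡ-∨D (x , x∈d) (y , y∈d) (z , z∈d) = begin
    x · (y + z)      ≡⟨ ·≡∥ x (y + z) x∈d (+-closed y z y∈d z∈d) ⟩
    x ∥ (y + z)      ≡⟨ ∥-distribˡ x y z ⟩
    x ∥ y + x ∥ z    ≡⟨ cong₂ _+_ (·≡∥ x y x∈d y∈d) (·≡∥ x z x∈d z∈d) ⟨
    x · y + x · z    ∎

  d-isDistributiveLattice : IsDistributiveLattice _≈D_ _≤D_ _∨D_ _∧D_
  d-isDistributiveLattice = record
    { isLattice = record
      { isPartialOrder = On.isPartialOrder proj₁ ≤-isPartialOrder
      ; supremum       = ∨D-supremum
      ; infimum        = ∧D-infimum
      }
    ; ∧-distribˡ-∨ = ∧D-distribˡ-∨D
    }

proposition15 : {c : Level} (S : CTrioid c) → let open CTrioid S in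
    Σ (InD 𝟘) λ p0 → Σ (InD 1σ) λ p1 →
    Σ (ClosedUnder _+_) λ cl+ → Σ (ClosedUnder _·_) λ cl· →
    ClosedUnder _∥_
    × (∀ x y → InD x → InD y → x · y ≡ x ∥ y)
    × IsDistributiveLattice _≈D_ _≤D_ (restrict _+_ cl+) (restrict _·_ cl·)
    × Minimum _≤D_ (𝟘 , p0)
    × Maximum _≤D_ (1σ , p1)
proposition15 S =
    𝟘∈d S , 1σ∈d S , +-closed S , ·-closed S
  , ∥-closed S
  , ·≡∥ S
  , d-isDistributiveLattice S
  , (λ (x , _) → +-identityˡ x)
  , (λ (_ , x∈d) → InD⇒≤1σ S x∈d)
  where open CTrioid S
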